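{- Let $L$ be a residuated lattice and $n\geq 1$ an integer. Every $n$-fold positive implicative filter of $L$ is an $n$-fold normal filter of $L$.
   Context: A residuated lattice is an algebra $(L,\wedge,\vee,\otimes,\rightarrow,0,1)$ such that $(L,\wedge,\vee,0,1)$ is a bounded lattice, $(L,\otimes,1)$ is a commutative monoid, and $x\otimes y\leq z$ iff $x\leq y\rightarrow z$. A filter of $L$ is a nonempty subset closed under $\otimes$ and upward closed. For $x\in L$, $x^n=x\otimes\cdots\otimes x$ ($n$ factors). A subset $F\subseteq L$ is an $n$-fold positive implicative filter if $1\in F$ and for all $x,y,z\in L$: $x\rightarrow((y^n\rightarrow z)\rightarrow y)\in F$ and $x\in F$ imply $y\in F$. A filter $F$ of $L$ is an $n$-fold normal filter if for all $x,y\in L$: $(y^n\rightarrow x)\rightarrow x\in F$ implies $(x\rightarrow y)\rightarrow y\in F$. -}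

module Defs where

open import Level using (Level; _⊔_; suc)
open import Data.Nat using (ℕ; zero)
import Data.Nat as ℕ
open import Data.Product using (_×_; ∃)
open import Relation.Binary.PropositionalEquality using (_≡_)

record ResiduatedLattice (c : Level) : Set (suc c) where
  infixr 6 _∨_
  infixr 7 _∧_
  infixr 7 _⊗_
  infixr 5 _⇒_
  infix 4 _≤_
  field
    Carrier : Set c
    _∧_ _∨_ _⊗_ _⇒_ : Carrier → Carrier → Carrier
    𝟘 𝟙 : Carrier
    ∧-comm : ∀ x y → x ∧ y ≡ y ∧ x
    ∨-comm : ∀ x y → x ∨ y ≡ y ∨ x
    ∧-assoc : ∀ x y z → (x ∧ y) ∧ z ≡ x ∧ (y ∧ z)
    ∨-assoc : ∀ x y z → (x ∨ y) ∨ z ≡ x ∨ (y ∨ z)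
    ∧-absorbs-∨ : ∀ x y → x ∧ (x ∨ y) ≡ x
    ∨-absorbs-∧ : ∀ x y → x ∨ (x ∧ y) ≡ x
    𝟘-least : ∀ x → 𝟘 ∧ x ≡ 𝟘
    𝟙-greatest : ∀ x → x ∧ 𝟙 ≡ x
    ⊗-comm : ∀ x y → x ⊗ y ≡ y ⊗ x
    ⊗-assoc : ∀ x y z → (x ⊗ y) ⊗ z ≡ x ⊗ (y ⊗ z)
    ⊗-identityˡ : ∀ x → 𝟙 ⊗ x ≡ x

  _≤_ : Carrier → Carrier → Set c
  x ≤ y = x ∧ y ≡ x

  field
    residuated→ : ∀ x y z → x ⊗ y ≤ z → x ≤ y ⇒ z
    residuated← : ∀ x y z → x ≤ y ⇒ z → x ⊗ y ≤ z

  -- x ^ n = x ⊗ ⋯ ⊗ x (n factors); x ^ 0 = 1 by convention (only n ≥ 1 is used)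
  _^_ : Carrier → ℕ → Carrier
  x ^ zero = 𝟙
  x ^ ℕ.suc zero = x
  x ^ ℕ.suc (ℕ.suc n) = x ⊗ (x ^ ℕ.suc n)

module _ {c : Level} (L : ResiduatedLattice c) where
  open ResiduatedLattice L

  record IsFilter {ℓ : Level} (F : Carrier → Set ℓ) : Set (c ⊔ ℓ) where
    field
      nonempty : ∃ F
      ⊗-closed : ∀ {x y} → F x → F y → F (x ⊗ y)
      up-closed : ∀ {x y} → F x → x ≤ y → F y

  record IsNFoldPosImplFilter {ℓ : Level} (n : ℕ) (F : Carrier → Set ℓ) : Set (c ⊔ ℓ) where
    field
      has-𝟙 : F 𝟙
      pi-rule : ∀ x y z → F (x ⇒ ((y ^ n ⇒ z) ⇒ y)) → F x → F y

  record IsNFoldNormalFilter {ℓ : Level} (n : ℕ) (F : Carrier → Set ℓ) : Set (c ⊔ ℓ) where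
    field
      isFilter : IsFilter F
      normal : ∀ x y → F ((y ^ n ⇒ x) ⇒ x) → F ((x ⇒ y) ⇒ y)

-- For a set F satisfying the n-fold positive implicative rule we then show:
-- (1) whenever a ≤ (y ^ n ⇒ z) ⇒ y and a ∈ F, also y ∈ F, because the
--     hypothesis a ⇒ ((y ^ n ⇒ z) ⇒ y) of the rule equals 𝟙 ∈ F;
-- (2) consequently F is upward closed, closed under modus ponens and under
--     ⊗, i.e. a filter.
-- For normality put X = (y ^ n ⇒ x) ⇒ x and w = (x ⇒ y) ⇒ y.  Since y ≤ w,
-- we get X ≤ (w ^ n ⇒ x) ⇒ w, so X ∈ F yields w ∈ F by (1).
module Submission where

open import Defs
open import Level using (Level)
open import Data.Nat using (ℕ; _≥_; zero; suc)
open import Data.Product using (_,_)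
open import Relation.Binary.PropositionalEquality
  using (_≡_; sym; trans; cong; subst; subst₂)

module ResiduatedLatticeProperties {c : Level} (L : ResiduatedLattice c) where
  open ResiduatedLattice L

  ≤-refl : ∀ x → x ≤ x
  ≤-refl x = trans (cong (x ∧_) (sym (∨-absorbs-∧ x x))) (∧-absorbs-∨ x (x ∧ x))

  ≤-trans : ∀ {x y z} → x ≤ y → y ≤ z → x ≤ z
  ≤-trans {x} {y} {z} x≤y y≤z =
    trans (cong (_∧ z) (sym x≤y)) (trans (∧-assoc x y z) (trans (cong (x ∧_) y≤z) x≤y))

  ≤-antisym : ∀ {x y} → x ≤ y → y ≤ x → x ≡ y
  ≤-antisym {x} {y} x≤y y≤x = trans (sym x≤y) (trans (∧-comm x y) y≤x)

  ≤-𝟙 : ∀ x → x ≤ 𝟙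
  ≤-𝟙 = 𝟙-greatest

  ⊗-identityʳ : ∀ x → x ⊗ 𝟙 ≡ x
  ⊗-identityʳ x = trans (⊗-comm x 𝟙) (⊗-identityˡ x)

  ⇒-eval : ∀ a b → (a ⇒ b) ⊗ a ≤ b
  ⇒-eval a b = residuated← _ _ _ (≤-refl _)

  ≤-double-⇒ : ∀ a b → a ≤ (a ⇒ b) ⇒ b
  ≤-double-⇒ a b = residuated→ _ _ _ (subst (_≤ b) (⊗-comm _ _) (⇒-eval a b))

  ⊗-monoˡ : ∀ {x y} z → x ≤ y → x ⊗ z ≤ y ⊗ z
  ⊗-monoˡ z x≤y = residuated← _ _ _ (≤-trans x≤y (residuated→ _ _ _ (≤-refl _)))

  ⊗-monoʳ : ∀ {x y} z → x ≤ y → z ⊗ x ≤ z ⊗ y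
  ⊗-monoʳ {x} {y} z x≤y = subst₂ _≤_ (⊗-comm x z) (⊗-comm y z) (⊗-monoˡ z x≤y)

  ⊗-decreasing : ∀ x y → x ⊗ y ≤ x
  ⊗-decreasing x y = subst (x ⊗ y ≤_) (⊗-identityʳ x) (⊗-monoʳ x (≤-𝟙 y))

  ≤-⇒ : ∀ a b → b ≤ a ⇒ b
  ≤-⇒ a b = residuated→ _ _ _ (⊗-decreasing b a)

  ⇒-monoʳ : ∀ a {b c} → b ≤ c → a ⇒ b ≤ a ⇒ c
  ⇒-monoʳ a b≤c = residuated→ _ _ _ (≤-trans (⇒-eval a _) b≤c)

  ⇒-antiˡ : ∀ {a b} c → a ≤ b → b ⇒ c ≤ a ⇒ c
  ⇒-antiˡ c a≤b = residuated→ _ _ _ (≤-trans (⊗-monoʳ _ a≤b) (⇒-eval _ c))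

  ⇒-𝟙 : ∀ {a b} → a ≤ b → a ⇒ b ≡ 𝟙
  ⇒-𝟙 {a} {b} a≤b = ≤-antisym (≤-𝟙 _)
    (residuated→ _ _ _ (subst (_≤ b) (sym (⊗-identityˡ a)) a≤b))

  ^-mono : ∀ {y w} n → y ≤ w → y ^ n ≤ w ^ n
  ^-mono zero          y≤w = ≤-refl _
  ^-mono (suc zero)    y≤w = y≤w
  ^-mono {y} {w} (suc (suc n)) y≤w =
    ≤-trans (⊗-monoˡ (y ^ suc n) y≤w) (⊗-monoʳ w (^-mono (suc n) y≤w))

module PositiveImplicativeProperties
  {c ℓ : Level} (L : ResiduatedLattice c) (n : ℕ)
  {F : ResiduatedLattice.Carrier L → Set ℓ} (pi : IsNFoldPosImplFilter L n F) where
  open ResiduatedLattice L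
  open ResiduatedLatticeProperties L
  open IsNFoldPosImplFilter pi

  -- The rule in order-theoretic form: its first premise is 𝟙 whenever
  -- a ≤ (y ^ n ⇒ z) ⇒ y.
  pi-rule-≤ : ∀ {a y} z → a ≤ (y ^ n ⇒ z) ⇒ y → F a → F y
  pi-rule-≤ {a} {y} z a≤ Fa = pi-rule a y z (subst F (sym (⇒-𝟙 a≤)) has-𝟙) Fa

  up-closed : ∀ {x y} → F x → x ≤ y → F y
  up-closed {y = y} Fx x≤y = pi-rule-≤ y (≤-trans x≤y (≤-⇒ _ y)) Fx

  modus-ponens : ∀ {a b} → F a → F (a ⇒ b) → F b
  modus-ponens {a} {b} Fa Fa⇒b =
    pi-rule a b b (up-closed Fa⇒b (⇒-monoʳ a (≤-⇒ _ b))) Fa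

  -- x ⊗ y follows from y and y ⇒ x ⊗ y, the latter being above x.
  ⊗-closed : ∀ {x y} → F x → F y → F (x ⊗ y)
  ⊗-closed Fx Fy = modus-ponens Fy (up-closed Fx (residuated→ _ _ _ (≤-refl _)))

  isFilter : IsFilter L F
  isFilter = record { nonempty = 𝟙 , has-𝟙 ; ⊗-closed = ⊗-closed ; up-closed = up-closed }

-- The key inequality: with w = (x ⇒ y) ⇒ y,
--   (y ^ n ⇒ x) ⇒ x ≤ (w ^ n ⇒ x) ⇒ w,
-- because y ≤ w gives w ^ n ⇒ x ≤ y ^ n ⇒ x, and x ≤ w.
normal-≤ : ∀ {c} (L : ResiduatedLattice c) (n : ℕ) →
  let open ResiduatedLattice L in
  ∀ x y → let w = (x ⇒ y) ⇒ y in (y ^ n ⇒ x) ⇒ x ≤ (w ^ n ⇒ x) ⇒ w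
normal-≤ L n x y = residuated→ _ _ _
  (≤-trans (≤-trans (⊗-monoʳ _ (⇒-antiˡ x (^-mono n (≤-⇒ _ y)))) (⇒-eval _ x))
           (≤-double-⇒ x y))
  where
  open ResiduatedLattice L
  open ResiduatedLatticeProperties L

proposition6p4 : ∀ {c ℓ : Level} (L : ResiduatedLattice c) (n : ℕ) → n ≥ 1 →
    (F : ResiduatedLattice.Carrier L → Set ℓ) →
    IsNFoldPosImplFilter L n F → IsNFoldNormalFilter L n F
proposition6p4 L n _ F pi = record
  { isFilter = isFilter
  ; normal   = λ x y FX → pi-rule-≤ x (normal-≤ L n x y) FX
  }
  where open PositiveImplicativeProperties L n pi
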